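{- Let $\ell$ be a finite set with at least two elements, $\mathfrak B$ its Lyndon algebra, and $\vartheta$ an embedding of $\mathfrak B$ into a full coset relation algebra $\mathfrak C[\mathcal F]$ whose equivalence relation $\mathcal E$ is $I\times I$. Let $p\in\ell$ and define $x\sim_p y$ (for $x,y\in I$) iff $G_x\times G_y\subseteq\vartheta(p+1')$. Then for every $x\in I$ there is a $y\in I$ such that $x\not\sim_p y$.
   Context: Lyndon algebra: take $1'\notin\ell$, $\ell^+=\ell\cup\{1'\}$; Boolean part all subsets of $\ell^+$ (identify $p$ with $\{p\}$, so $p+1'=\{p,1'\}$); identity $1'$; converse the identity map; $p;q=\ell\setminus\{p,q\}$ for distinct $p,q\in\ell$, $p;p=p+1'$ for $p\in\ell$, $p;1'=1';p=p$, extended distributively. Full coset relation algebra: pairwise disjoint groups $\langle G_x:x\in I\rangle$ (operation $\circ$, identity $e_x$), $U=\bigcup_xG_x$; equivalence relation $\mathcal E$ on $I$; for $(x,y)\in\mathcal E$, $H_{xy}\trianglelefteq G_x$, $K_{xy}\trianglelefteq G_y$ and an isomorphism $\varphi_{xy}:G_x/H_{xy}\to G_y/K_{xy}$; cosets $H_{xy,\gamma}$ ($\gamma<\kappa_{xy}$, no repetition, $H_{xy,0}=H_{xy}$), $K_{xy,\gamma}=\varphi_{xy}(H_{xy,\gamma})$, $R_{xy,\alpha}=\bigcup_\gamma H_{xy,\gamma}\times(K_{xy,\gamma}\circ K_{xy,\alpha})$; $A$ = all unions of sets of such relations, unit $\bigcup_{(x,y)\in\mathcal E}G_x\times G_y$,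 assumed to contain $\mathrm{id}_U$ and be closed under converse and relational composition; cosets $C_{xyz}$ of $H_{xy}\circ H_{xz}$ in $G_x$ for $(x,y),(y,z)\in\mathcal E$; $R_{xy,\alpha}\otimes R_{yz,\beta}=\bigcup\{R_{xz,\gamma}:H_{xz,\gamma}\subseteq\varphi_{xy}^{ -1}[K_{xy,\alpha}\circ H_{yz,\beta}]\circ C_{xyz}\}$, $R_{xy,\alpha}\otimes R_{wz,\beta}=\varnothing$ for $y\ne w$, extended distributively; $\mathfrak C[\mathcal F]=(A,\cup,\sim,\otimes,{}^{ -1},\mathrm{id}_U)$ is assumed to be a relation algebra. An embedding is an injective relation-algebra homomorphism. -}

module Defs where

open import Level using (Level)
open import Data.Nat using (ℕ; suc)
open import Data.Fin using (Fin; zero; suc; _≟_)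
open import Data.Fin.Subset using (Subset; _∪_; ∁; ⁅_⁆)
open import Data.Bool using (Bool; true; false; _∧_; _∨_; if_then_else_)
open import Data.Vec using (lookup; tabulate)
open import Data.Product using (Σ; ∃; ∃-syntax; _×_; _,_)
open import Data.Sum using (_⊎_)
open import Relation.Nullary using (¬_; does)
open import Relation.Binary.PropositionalEquality using (_≡_)
open import Algebra.Structures using (IsGroup)
open import Function.Bundles using (_⇔_)

-- Lyndon algebra of ℓ = Fin n.
-- ℓ⁺ = ℓ ∪ {1'} is represented by Fin (suc n): zero plays the role of 1',
-- suc p plays the role of p ∈ ℓ.  Elements are subsets of ℓ⁺.

LSub : ℕ → Set
LSub n = Subset (suc n)

idL : ∀ {n} → LSub n
idL = ⁅ zero ⁆

p+1' : ∀ {n} → Fin n → LSub n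
p+1' p = ⁅ suc p ⁆ ∪ ⁅ zero ⁆

atomComp : ∀ {n} → Fin (suc n) → Fin (suc n) → LSub n
atomComp zero b = ⁅ b ⁆
atomComp (suc p) zero = ⁅ suc p ⁆
atomComp (suc p) (suc q) =
  if does (p ≟ q) then ⁅ suc p ⁆ ∪ ⁅ zero ⁆
  else ∁ (⁅ zero ⁆ ∪ (⁅ suc p ⁆ ∪ ⁅ suc q ⁆))

anyFin : ∀ {m} → (Fin m → Bool) → Bool
anyFin {ℕ.zero} f = false
anyFin {suc m} f = f zero ∨ anyFin (λ i → f (suc i))

_⨾L_ : ∀ {n} → LSub n → LSub n → LSub n
X ⨾L Y = tabulate λ c → anyFin λ a → anyFin λ b →
  lookup X a ∧ (lookup Y b ∧ lookup (atomComp a b) c)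

convL : ∀ {n} → LSub n → LSub n
convL X = X

record IsNormalSubgroup {A : Set} (_∙_ : A → A → A) (ε : A) (inv : A → A)
                        (N : A → Set) : Set where
  field
    ε∈          : N ε
    ∙-closed    : ∀ {a b} → N a → N b → N (a ∙ b)
    inv-closed  : ∀ {a} → N a → N (inv a)
    conj-closed : ∀ g {a} → N a → N ((g ∙ a) ∙ inv g)

-- Coset systems F with equivalence relation E = I × I.
-- Groups G x (x : I) with propositional equality; they are automatically
-- pairwise disjoint since U = Σ I G.
-- The isomorphism φ_xy : G_x / H_xy → G_y / K_xy is represented by a lift
-- φ x y : G x → G y which respects and reflects the coset congruences, is a
-- homomorphism modulo K_xy and is surjective modulo K_xy.
-- C_xyz is the coset  c x y z ∘ (H_xy ∘ H_xz)  of H_xy ∘ H_xz in G_x.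

record CosetSystem : Set₁ where
  field
    I   : Set
    G   : I → Set
    _·_ : ∀ {x} → G x → G x → G x
    ε   : ∀ x → G x
    inv : ∀ {x} → G x → G x
    isGroup : ∀ x → IsGroup _≡_ (_·_ {x}) (ε x) (inv {x})
    H   : ∀ x y → G x → Set
    K   : ∀ x y → G y → Set
    H-normal : ∀ x y → IsNormalSubgroup (_·_ {x}) (ε x) inv (H x y)
    K-normal : ∀ x y → IsNormalSubgroup (_·_ {y}) (ε y) inv (K x y)
    φ   : ∀ x y → G x → G y

  _~⟨_⟩_ : ∀ {x} → G x → (G x → Set) → G x → Set
  g ~⟨ N ⟩ g' = N (inv g · g')

  field
    φ-iso  : ∀ (x y : I) (g g' : G x) →
             (g ~⟨ H x y ⟩ g') ⇔ (φ x y g ~⟨ K x y ⟩ φ x y g')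
    φ-hom  : ∀ (x y : I) (g g' : G x) →
             φ x y (g · g') ~⟨ K x y ⟩ (φ x y g · φ x y g')
    φ-surj : ∀ (x y : I) (h : G y) → ∃[ g ] (φ x y g ~⟨ K x y ⟩ h)
    c      : ∀ (x y z : I) → G x

module _ (𝓕 : CosetSystem) where
  open CosetSystem 𝓕

  U : Set
  U = Σ I G

  Rel : Set₁
  Rel = U → U → Set

  -- R_{xy,α}, where the coset K_{xy,α} of K_xy in G_y is given by a
  -- representative a :  R_{xy,α} = ⋃_γ H_{xy,γ} × (K_{xy,γ} ∘ K_{xy,α})
  R : (x y : I) → G y → Rel
  R x y a u v = ∃[ g ] ∃[ h ] (u ≡ (x , g)) × (v ≡ (y , h)) ×
                (h ~⟨ K x y ⟩ (φ x y g · a))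

  Atom : Set
  Atom = Σ I λ x → Σ I λ y → G y

  R[_] : Atom → Rel
  R[ (x , y , a) ] = R x y a

  _⊆ᵣ_ : Rel → Rel → Set
  S ⊆ᵣ T = ∀ u v → S u v → T u v

  _≐_ : Rel → Rel → Set
  S ≐ T = ∀ u v → S u v ⇔ T u v

  -- the universe A: all unions of sets of the relations R_{xy,α}
  InA : Rel → Set₁
  InA S = Σ (Atom → Set) λ P → (∀ u v → S u v ⇔ (Σ Atom λ t → (P t × R[ t ] u v)))

  _∪ᵣ_ : Rel → Rel → Rel
  (S ∪ᵣ T) u v = S u v ⊎ T u v

  -- complement relative to the unit U × U (E = I × I)
  ∼ᵣ_ : Rel → Rel
  (∼ᵣ S) u v = ¬ S u v

  _˘ : Rel → Rel
  (S ˘) u v = S v u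

  Idᵣ : Rel
  Idᵣ u v = u ≡ v

  _∘ᵣ_ : Rel → Rel → Rel
  (S ∘ᵣ T) u v = ∃[ w ] (S u w × T w v)

  -- H_{xz,γ} ⊆ φ_xy⁻¹[K_{xy,α} ∘ H_{yz,β}] ∘ C_xyz, where the cosets are
  -- given by representatives a (of K_{xy,α}), b (of K_{yz,β}), d (of K_{xz,γ})
  ShiftCond : (x y z : I) → G y → G z → G z → Set
  ShiftCond x y z a b d =
    ∀ (g : G x) → φ x z g ~⟨ K x z ⟩ d →
      ∃[ g₁ ] ∃[ g₂ ] (g ≡ g₁ · g₂) ×
        (∃[ s ] (φ x y g₁ ~⟨ K x y ⟩ s) ×
           (∃[ k ] ∃[ h ] (s ≡ k · h) × (k ~⟨ K x y ⟩ a) × (φ y z h ~⟨ K y z ⟩ b))) ×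
        (Σ (G x) λ h₁ → Σ (G x) λ h₂ → (g₂ ≡ c x y z · (h₁ · h₂)) × H x y h₁ × H x z h₂)

  _⊗_ : Rel → Rel → Rel
  (S ⊗ T) u v = ∃[ x ] ∃[ y ] ∃[ z ] ∃[ a ] ∃[ b ] ∃[ d ]
    (R x y a ⊆ᵣ S) × (R y z b ⊆ᵣ T) × ShiftCond x y z a b d × R x z d u v

  -- standing assumptions: A contains id_U, is closed under converse and
  -- relational composition, and ℭ[F] = (A, ∪, ∼, ⊗, ˘, id_U) is a relation
  -- algebra (Tarski's axioms, Boolean part via Huntington's axiom).
  record IsCosetRA : Set₁ where
    field
      Id-in   : InA Idᵣ
      ˘-closed : ∀ {S} → InA S → InA (S ˘)
      ∘-closed : ∀ {S T} → InA S → InA T → InA (S ∘ᵣ T)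
      ∪-closed : ∀ {S T} → InA S → InA T → InA (S ∪ᵣ T)
      ∼-closed : ∀ {S} → InA S → InA (∼ᵣ S)
      ⊗-closed : ∀ {S T} → InA S → InA T → InA (S ⊗ T)
      huntington : ∀ {S T} → InA S → InA T →
        ((∼ᵣ ((∼ᵣ S) ∪ᵣ T)) ∪ᵣ (∼ᵣ ((∼ᵣ S) ∪ᵣ (∼ᵣ T)))) ≐ S
      ⊗-assoc : ∀ {S T W} → InA S → InA T → InA W →
        ((S ⊗ T) ⊗ W) ≐ (S ⊗ (T ⊗ W))
      ⊗-identityʳ : ∀ {S} → InA S → (S ⊗ Idᵣ) ≐ S
      ⊗-distribʳ : ∀ {S T W} → InA S → InA T → InA W →
        ((S ∪ᵣ T) ⊗ W) ≐ ((S ⊗ W) ∪ᵣ (T ⊗ W))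
      ˘-⊗ : ∀ {S T} → InA S → InA T → ((S ⊗ T) ˘) ≐ ((T ˘) ⊗ (S ˘))
      tarski : ∀ {S T} → InA S → InA T →
        (((S ˘) ⊗ (∼ᵣ (S ⊗ T))) ∪ᵣ (∼ᵣ T)) ≐ (∼ᵣ T)

  record IsEmbedding {n : ℕ} (ϑ : LSub n → Rel) : Set₁ where
    field
      ϑ-in  : ∀ X → InA (ϑ X)
      ϑ-∪   : ∀ X Y → ϑ (X ∪ Y) ≐ (ϑ X ∪ᵣ ϑ Y)
      ϑ-∁   : ∀ X → ϑ (∁ X) ≐ (∼ᵣ ϑ X)
      ϑ-⨾   : ∀ X Y → ϑ (X ⨾L Y) ≐ (ϑ X ⊗ ϑ Y)
      ϑ-˘   : ∀ X → ϑ (convL X) ≐ (ϑ X ˘)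
      ϑ-id  : ϑ idL ≐ Idᵣ
      ϑ-inj : ∀ X Y → ϑ X ≐ ϑ Y → X ≡ Y

  Sim : ∀ {n} → (LSub n → Rel) → Fin n → I → I → Set
  Sim ϑ p x y = ∀ (g : G x) (h : G y) → ϑ (p+1' p) (x , g) (y , h)

module Submission where

open import Defs
open import Data.Nat using (ℕ; _≤_; suc; s≤s; z≤n)
open import Data.Fin using (Fin; zero; suc; _≟_; punchIn)
open import Data.Fin.Properties using (suc-injective; punchInᵢ≢i)
open import Data.Fin.Subset using (Subset; _∪_; ∁; ⁅_⁆; _∈_; _⊆_)
open import Data.Fin.Subset.Properties
  using (⊆-antisym; q⊆p∪q; x∈p∪q⁺; x∈p∪q⁻; x∈⁅x⁆; x∈⁅y⁆⇒x≡y; x∉p⇒x∈∁p)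
open import Data.Bool using (Bool; true; false; _∧_)
open import Data.Vec using (lookup)
open import Data.Vec.Properties using (lookup∘tabulate; lookup⇒[]=; []=⇒lookup)
open import Data.Product using (∃-syntax; _,_)
open import Data.Sum using (inj₁; inj₂; [_,_])
open import Function using (_∘_; id)
open import Function.Bundles using (Equivalence)
open import Relation.Nullary using (¬_)
open import Relation.Nullary.Decidable using (dec-true)
open import Relation.Binary.PropositionalEquality using (_≡_; _≢_; refl; sym; trans; subst)
open import Algebra.Structures using (IsGroup)

-- Idea: pick q ≠ p in ℓ. Since 1' ≤ q;q, the pair (e_x, e_x) lies in ϑ(q) ⊗ ϑ(q), so
-- some atom R_{xy,α} ⊆ ϑ(q) starts in G_x; it relates e_x to some h ∈ G_y. As q and
-- p + 1' are disjoint, (e_x, h) ∉ ϑ(p + 1'), whence x ≁_p y.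

∪-absorbˡ : ∀ {k} {X Y : Subset k} → X ⊆ Y → X ∪ Y ≡ Y
∪-absorbˡ {X = X} {Y} X⊆Y =
  ⊆-antisym ([ X⊆Y , id ] ∘ x∈p∪q⁻ X Y) (q⊆p∪q X Y)

∃≢ : ∀ {n} → 2 ≤ n → (p : Fin n) → ∃[ q ] p ≢ q
∃≢ (s≤s (s≤s z≤n)) p = punchIn p zero , punchInᵢ≢i p zero ∘ sym

anyFin-intro : ∀ {m} (f : Fin m → Bool) (i : Fin m) → f i ≡ true → anyFin f ≡ true
anyFin-intro f zero    fi≡true rewrite fi≡true = refl
anyFin-intro f (suc i) fi≡true with f zero
... | true  = refl
... | false = anyFin-intro (f ∘ suc) i fi≡true

module _ {n : ℕ} where

  ∈-⨾L : ∀ {X Y : LSub n} {a b c} → a ∈ X → b ∈ Y → c ∈ atomComp a b → c ∈ X ⨾L Y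
  ∈-⨾L {X} {Y} {a} {b} {c} a∈X b∈Y c∈ab = lookup⇒[]= c (X ⨾L Y) (trans
    (lookup∘tabulate (λ c → anyFin (λ a → anyFin (witness a c))) c)
    (anyFin-intro (λ a → anyFin (witness a c)) a (anyFin-intro (witness a c) b witness≡true)))
    where
    witness : Fin (suc n) → Fin (suc n) → Fin (suc n) → Bool
    witness a c b = lookup X a ∧ (lookup Y b ∧ lookup (atomComp a b) c)
    witness≡true : witness a c b ≡ true
    witness≡true rewrite []=⇒lookup a∈X | []=⇒lookup b∈Y | []=⇒lookup c∈ab = refl

  1'∈q⨾q : ∀ (q : Fin n) → zero ∈ atomComp (suc q) (suc q)
  1'∈q⨾q q rewrite dec-true (q ≟ q) refl = x∈p∪q⁺ {p = ⁅ suc q ⁆} (inj₂ (x∈⁅x⁆ zero))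

  1'⊆q⨾q : ∀ (q : Fin n) → idL ⊆ ⁅ suc q ⁆ ⨾L ⁅ suc q ⁆
  1'⊆q⨾q q i∈1' rewrite x∈⁅y⁆⇒x≡y zero i∈1' = ∈-⨾L (x∈⁅x⁆ (suc q)) (x∈⁅x⁆ (suc q)) (1'∈q⨾q q)

  q⊆∁[p+1'] : ∀ {p q : Fin n} → p ≢ q → ⁅ suc q ⁆ ⊆ ∁ (p+1' p)
  q⊆∁[p+1'] {p} {q} p≢q i∈q rewrite x∈⁅y⁆⇒x≡y (suc q) i∈q =
    x∉p⇒x∈∁p ([ p≢q ∘ sym ∘ suc-injective ∘ x∈⁅y⁆⇒x≡y (suc p) , (λ ()) ∘ x∈⁅y⁆⇒x≡y zero ]
              ∘ x∈p∪q⁻ ⁅ suc p ⁆ ⁅ zero ⁆)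

module _ (𝓕 : CosetSystem) where
  open CosetSystem 𝓕

  ~-refl : ∀ {x y} (g : G y) → g ~⟨ K x y ⟩ g
  ~-refl {x} {y} g = subst (K x y) (sym (inverseˡ g)) (IsNormalSubgroup.ε∈ (K-normal x y))
    where open IsGroup (isGroup y) using (inverseˡ)

  R-total : ∀ x y (a : G y) (g : G x) → R 𝓕 x y a (x , g) (y , φ x y g · a)
  R-total x y a g = g , φ x y g · a , refl , refl , ~-refl (φ x y g · a)

  ⊗-leftTotal : ∀ {S T : Rel 𝓕} {x g v} → _⊗_ 𝓕 S T (x , g) v → ∃[ y ] ∃[ h ] S (x , g) (y , h)
  ⊗-leftTotal (_ , y , _ , a , _ , _ , R⊆S , _ , _ , g , _ , refl , _) =
    y , φ _ y g · a , R⊆S _ _ (R-total _ y a g)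

  module _ {n} {ϑ : LSub n → Rel 𝓕} (emb : IsEmbedding 𝓕 ϑ) where
    open IsEmbedding emb

    ϑ-mono : ∀ {X Y} → X ⊆ Y → _⊆ᵣ_ 𝓕 (ϑ X) (ϑ Y)
    ϑ-mono {X} {Y} X⊆Y u v uXv =
      subst (λ Z → ϑ Z u v) (∪-absorbˡ X⊆Y) (Equivalence.from (ϑ-∪ X Y u v) (inj₁ uXv))

    ϑ-disjoint : ∀ {X Y} → X ⊆ ∁ Y → ∀ u v → ϑ X u v → ¬ ϑ Y u v
    ϑ-disjoint {X} {Y} X⊆∁Y u v = Equivalence.to (ϑ-∁ Y u v) ∘ ϑ-mono X⊆∁Y u v

lemma4p4 : (n : ℕ) → 2 ≤ n → (𝓕 : CosetSystem) → IsCosetRA 𝓕 →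
           (ϑ : LSub n → Rel 𝓕) → IsEmbedding 𝓕 ϑ →
           (p : Fin n) → (x : CosetSystem.I 𝓕) →
           ∃[ y ] ¬ Sim 𝓕 ϑ p x y
lemma4p4 n 2≤n 𝓕 _ ϑ emb p x =
  let q , p≢q       = ∃≢ 2≤n p
      y , h , e[q]h = ⊗-leftTotal 𝓕 (Equivalence.to (ϑ-⨾ ⁅ suc q ⁆ ⁅ suc q ⁆ e e) (e[q⨾q]e q))
  in  y , λ x∼y → ϑ-disjoint 𝓕 emb (q⊆∁[p+1'] p≢q) e (y , h) e[q]h (x∼y _ h)
  where
  open IsEmbedding emb using (ϑ-⨾; ϑ-id)
  e : U 𝓕
  e = x , CosetSystem.ε 𝓕 x
  e[q⨾q]e : ∀ q → ϑ (⁅ suc q ⁆ ⨾L ⁅ suc q ⁆) e e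
  e[q⨾q]e q = ϑ-mono 𝓕 emb (1'⊆q⨾q q) e e (Equivalence.from (ϑ-id e e) refl)
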